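{- Let $\mathcal{A}$ be an extensional $\mathbf{BI}(\_)^\bullet$-algebra and write $a\circ b=\mathbf{B}\,a\,b$. Then for all $a,b,c\in\mathcal{A}$: $a\circ(b\circ c)=(a\circ b)\circ c$ and $\mathbf{I}\circ a=a=a\circ\mathbf{I}$.
   Context: An applicative structure is a set $\mathcal{A}$ with a binary operation $(a,b)\mapsto a\cdot b$, written by juxtaposition $a\,b$ and associating to the left. An extensional $\mathbf{BI}(\_)^\bullet$-algebra is an applicative structure $\mathcal{A}$ with elements $\mathbf{B},\mathbf{I}\in\mathcal{A}$ and a function $\mathcal{A}\to\mathcal{A}$, $a\mapsto a^\bullet$, such that for all $a,b,c\in\mathcal{A}$: $\mathbf{I}\,a=a$; $\mathbf{B}\,a\,b\,c=a\,(b\,c)$; $a^\bullet\,b=b\,a$; $\mathbf{B}\,\mathbf{I}=\mathbf{I}$; $(a\,b)^\bullet=\mathbf{B}\,b^\bullet\,(\mathbf{B}\,a^\bullet\,\mathbf{B})$; $\mathbf{B}\,\mathbf{B}^\bullet\,(\mathbf{B}\,\mathbf{B}\,(\mathbf{B}\,\mathbf{B}\,\mathbf{B}))=\mathbf{B}\,(\mathbf{B}\,\mathbf{B})\,\mathbf{B}$; $\mathbf{B}\,\mathbf{I}^\bullet\,\mathbf{B}=\mathbf{I}$; $\mathbf{B}\,a^{\bullet\bullet}\,\mathbf{B}=\mathbf{B}\,(\mathbf{B}\,a^\bullet)\,\mathbf{B}$. -}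

module Defs where

open import Level using (Level; suc)
open import Relation.Binary.PropositionalEquality using (_≡_)

record ExtBIBulletAlgebra (ℓ : Level) : Set (suc ℓ) where
  infixl 20 _·_
  infix 30 _•
  infixr 15 _∘_
  field
    Carrier : Set ℓ
    _·_     : Carrier → Carrier → Carrier
    B       : Carrier
    I       : Carrier
    _•      : Carrier → Carrier

    I-ax     : ∀ a → I · a ≡ a
    B-ax     : ∀ a b c → B · a · b · c ≡ a · (b · c)
    •-ax     : ∀ a b → (a •) · b ≡ b · a
    BI≡I     : B · I ≡ I
    •-app    : ∀ a b → ((a · b) •) ≡ B · (b •) · (B · (a •) · B)
    B•-ax    : B · (B •) · (B · B · (B · B · B)) ≡ B · (B · B) · B
    BI•B≡I   : B · (I •) · B ≡ I
    ••-ax    : ∀ a → B · ((a •) •) · B ≡ B · (B · (a •)) · B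

  _∘_ : Carrier → Carrier → Carrier
  a ∘ b = B · a · b

{-# OPTIONS --safe #-}
module Submission where

-- Unfolding ∘ with the B axiom turns both sides of associativity into
-- terms applied to a, b, c; the one genuinely new equation is the
-- axiom B B• (B B (B B B)) = B (B B) B, evaluated at a via (x• ∘ g) y = g y x.
-- The units come from B I = I and B I• B = I in the same way.

open import Defs
open import Level using (Level)
open import Data.Product using (_×_; _,_)
open import Relation.Binary.PropositionalEquality
  using (_≡_; sym; trans; cong; module ≡-Reasoning)

module _ {ℓ : Level} (𝒜 : ExtBIBulletAlgebra ℓ) where
  open ExtBIBulletAlgebra 𝒜
  open ≡-Reasoning

  ∘-apply : ∀ f g x → (f ∘ g) · x ≡ f · (g · x)
  ∘-apply = B-ax

  •∘-apply : ∀ f g x → ((f •) ∘ g) · x ≡ g · x · f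
  •∘-apply f g x = trans (∘-apply (f •) g x) (•-ax f (g · x))

  ∘-assoc : ∀ a b c → a ∘ (b ∘ c) ≡ (a ∘ b) ∘ c
  ∘-assoc a b c = begin
    B · a · (B · b · c)                     ≡⟨ sym (∘-apply (B · a) (B · b) c) ⟩
    B · (B · a) · (B · b) · c               ≡⟨ cong (λ x → x · c) (sym B-reassociates) ⟩
    B · B · (B · B · B) · a · B · b · c     ≡⟨ cong (λ x → x · b · c) (sym (•∘-apply B _ a)) ⟩
    B · (B •) · (B · B · (B · B · B)) · a · b · c
                                            ≡⟨ cong (λ x → x · a · b · c) B•-ax ⟩
    B · (B · B) · B · a · b · c             ≡⟨ cong (λ x → x · b · c) (∘-apply (B · B) B a) ⟩
    B · B · (B · a) · b · c                 ≡⟨ cong (λ x → x · c) (∘-apply B (B · a) b) ⟩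
    B · (B · a · b) · c                     ∎
    where
    B-reassociates : B · B · (B · B · B) · a · B · b ≡ B · (B · a) · (B · b)
    B-reassociates = begin
      B · B · (B · B · B) · a · B · b       ≡⟨ cong (λ x → x · B · b) (∘-apply B (B · B · B) a) ⟩
      B · (B · B · B · a) · B · b           ≡⟨ ∘-apply (B · B · B · a) B b ⟩
      B · B · B · a · (B · b)               ≡⟨ cong (λ x → x · (B · b)) (∘-apply B B a) ⟩
      B · (B · a) · (B · b)                 ∎

  ∘-identityˡ : ∀ a → I ∘ a ≡ a
  ∘-identityˡ a = trans (cong (_· a) BI≡I) (I-ax a)

  ∘-identityʳ : ∀ a → a ≡ a ∘ I
  ∘-identityʳ a = begin
    a                  ≡⟨ sym (I-ax a) ⟩
    I · a              ≡⟨ cong (_· a) (sym BI•B≡I) ⟩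
    ((I •) ∘ B) · a    ≡⟨ •∘-apply I B a ⟩
    B · a · I          ∎

lemma3p2 : {ℓ : Level} (𝒜 : ExtBIBulletAlgebra ℓ) →
    let open ExtBIBulletAlgebra 𝒜 in
    ∀ (a b c : Carrier) →
      (a ∘ (b ∘ c) ≡ (a ∘ b) ∘ c) × (I ∘ a ≡ a) × (a ≡ a ∘ I)
lemma3p2 𝒜 a b c = ∘-assoc 𝒜 a b c , ∘-identityˡ 𝒜 a , ∘-identityʳ 𝒜 a
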